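{- Let $d\ge1$, $\ell\ge 2$ and let $u,v$ be vertices of the cyclic Kautz digraph $CK(d,\ell)$. There is a directed path from $u$ to $v$ in $CK(d,\ell)$ if and only if $v$ can be obtained from $u$ by a finite sequence of the following operations: (1) rotation: replacing a vertex $w_1w_2\ldots w_\ell$ by $w_{k+1}\ldots w_\ell w_1\ldots w_k$ for some $k$; (2) valid swap: replacing one symbol $w_i$ of a vertex $w_1\ldots w_\ell$ by a symbol $x$ that differs from both of its cyclic neighbours $w_{i-1}$ and $w_{i+1}$ (indices taken modulo $\ell$).
   Context: Let $\Sigma$ be an alphabet of $d+1$ distinct symbols. The cyclic Kautz digraph $CK(d,\ell)$ has as vertices all words $a_1\ldots a_\ell$ over $\Sigma$ with $a_i\ne a_{i+1}$ for $1\le i\le\ell-1$ and $a_1\ne a_\ell$ (equivalently, cyclic arrangements of $\ell$ symbols with a marked starting position, in which cyclically adjacent symbols differ), and an arc from $a_1a_2\ldots a_\ell$ to $a_2\ldots a_\ell a_{\ell+1}$ whenever both words are vertices. Both operations map vertices to vertices. -}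

module Defs where

open import Data.Nat using (ℕ; zero; suc; _+_)
open import Data.Nat.DivMod using (_mod_)
open import Data.Fin using (Fin; toℕ)
open import Data.Vec using (Vec; lookup; tabulate; tail; _∷ʳ_; _[_]≔_)
open import Data.Product using (Σ; ∃; _×_; _,_)
open import Data.Sum using (_⊎_)
open import Relation.Binary.PropositionalEquality using (_≡_; _≢_)

-- Words of length ℓ = suc m over the alphabet Σ = Fin (suc d) (d+1 symbols).
Word : ℕ → ℕ → Set
Word d m = Vec (Fin (suc d)) (suc m)

next : {m : ℕ} → Fin (suc m) → Fin (suc m)
next {m} i = (suc (toℕ i)) mod (suc m)

prev : {m : ℕ} → Fin (suc m) → Fin (suc m)
prev {m} i = (toℕ i + m) mod (suc m)

IsVertex : {d m : ℕ} → Word d m → Set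
IsVertex {d} {m} w = (i : Fin (suc m)) → lookup w i ≢ lookup w (next i)

Arc : {d m : ℕ} → Word d m → Word d m → Set
Arc {d} {m} u v =
  IsVertex u × IsVertex v × Σ (Fin (suc d)) (λ x → v ≡ tail u ∷ʳ x)

data Path {d m : ℕ} : Word d m → Word d m → Set where
  here  : {u : Word d m} → Path u u
  there : {u w v : Word d m} → Arc u w → Path w v → Path u v

rotate : {d m : ℕ} → Word d m → ℕ → Word d m
rotate {d} {m} w k = tabulate (λ i → lookup w ((toℕ i + k) mod (suc m)))

data Op {d m : ℕ} : Word d m → Word d m → Set where
  rot  : (w : Word d m) (k : ℕ) → Op w (rotate w k)
  swap : (w : Word d m) (i : Fin (suc m)) (x : Fin (suc d)) →
         x ≢ lookup w (prev i) → x ≢ lookup w (next i) →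
         Op w (w [ i ]≔ x)

data Ops {d m : ℕ} : Word d m → Word d m → Set where
  done : {u : Word d m} → Ops u u
  step : {u w v : Word d m} → Op u w → Ops w v → Ops u v

-- An arc u → v appends a symbol x after dropping the first one, i.e. it rotates u by one and
-- then overwrites the last symbol by x; since v is a vertex, that overwrite is a valid swap.
-- Conversely, a rotation by k is a path of k arcs, and a valid swap of position i by x is
-- the path that rotates by i, appends x (reaching the swapped word rotated by i + 1), and
-- rotates by ℓ − i − 1 back to the start.  Positions are read cyclically, w_n := w_(n mod ℓ).
module Submission where

open import Defs
open import Data.Nat using (ℕ; zero; suc; _+_; _*_; _∸_; _%_; _≤_)
open import Data.Nat.Properties using (+-comm; +-assoc; +-suc; +-identityʳ; *-suc; m∸n+n≡m)
open import Data.Nat.DivMod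
  using (_mod_; %-distribˡ-+; m%n%n≡m%n; [m+kn]%n≡m%n; [m+n]%n≡m%n; m<n⇒m%n≡m; n%n≡0)
open import Data.Fin using (Fin; toℕ; fromℕ; inject₁)
open import Data.Fin.Properties
  using (toℕ-injective; toℕ-fromℕ<; toℕ<n; toℕ-fromℕ; toℕ-inject₁; toℕ≤pred[n]; fromℕ≢inject₁; _≟_)
open import Data.Fin.Relation.Unary.Top using (View; view; ‵fromℕ; ‵inject₁)
open import Data.Vec using (Vec; _∷_; []; lookup; tabulate; tail; _∷ʳ_; _[_]≔_)
open import Data.Vec.Properties
  using (lookup∘tabulate; tabulate∘lookup; tabulate-cong; lookup∘update; lookup∘update′; []≔-lookup)
open import Data.Product using (_×_; _,_)
open import Function using (_∘_)
open import Relation.Nullary using (yes; no; contradiction)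
open import Relation.Binary.PropositionalEquality
open ≡-Reasoning

private
  variable
    d m : ℕ

[m%n+o]%n≡[m+o]%n : ∀ a b m → (a % suc m + b) % suc m ≡ (a + b) % suc m
[m%n+o]%n≡[m+o]%n a b m = begin
  (a % ℓ + b) % ℓ          ≡⟨ %-distribˡ-+ (a % ℓ) b ℓ ⟩
  (a % ℓ % ℓ + b % ℓ) % ℓ  ≡⟨ cong (λ r → (r + b % ℓ) % ℓ) (m%n%n≡m%n a ℓ) ⟩
  (a % ℓ + b % ℓ) % ℓ      ≡⟨ sym (%-distribˡ-+ a b ℓ) ⟩
  (a + b) % ℓ              ∎
  where
  ℓ : ℕ
  ℓ = suc m

[o+m%n]%n≡[o+m]%n : ∀ a b m → (b + a % suc m) % suc m ≡ (b + a) % suc m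
[o+m%n]%n≡[o+m]%n a b m = begin
  (b + a % suc m) % suc m  ≡⟨ cong (_% suc m) (+-comm b (a % suc m)) ⟩
  (a % suc m + b) % suc m  ≡⟨ [m%n+o]%n≡[m+o]%n a b m ⟩
  (a + b) % suc m          ≡⟨ cong (_% suc m) (+-comm a b) ⟩
  (b + a) % suc m          ∎

-- Adding k (1 + m), which vanishes modulo 1 + m, is adding k and then k m.
%-cancelʳ-+ : ∀ a b k m → (a + k) % suc m ≡ (b + k) % suc m → a % suc m ≡ b % suc m
%-cancelʳ-+ a b k m eq = begin
  a % ℓ                       ≡⟨ add-multiple a ⟩
  ((a + k) % ℓ + k * m) % ℓ  ≡⟨ cong (λ r → (r + k * m) % ℓ) eq ⟩
  ((b + k) % ℓ + k * m) % ℓ  ≡⟨ sym (add-multiple b) ⟩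
  b % ℓ                       ∎
  where
  ℓ : ℕ
  ℓ = suc m
  add-multiple : ∀ c → c % ℓ ≡ ((c + k) % ℓ + k * m) % ℓ
  add-multiple c = begin
    c % ℓ                       ≡⟨ sym ([m+kn]%n≡m%n c k ℓ) ⟩
    (c + k * ℓ) % ℓ             ≡⟨ cong (λ r → (c + r) % ℓ) (*-suc k m) ⟩
    (c + (k + k * m)) % ℓ       ≡⟨ cong (_% ℓ) (sym (+-assoc c k (k * m))) ⟩
    (c + k + k * m) % ℓ         ≡⟨ sym ([m%n+o]%n≡[m+o]%n (c + k) (k * m) m) ⟩
    ((c + k) % ℓ + k * m) % ℓ  ∎

[m+1+k]%[1+m]≡k%[1+m] : ∀ m k → (m + suc k) % suc m ≡ k % suc m
[m+1+k]%[1+m]≡k%[1+m] m k = begin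
  (m + suc k) % suc m  ≡⟨ cong (_% suc m) (trans (+-comm m (suc k)) (sym (+-suc k m))) ⟩
  (k + suc m) % suc m  ≡⟨ [m+n]%n≡m%n k (suc m) ⟩
  k % suc m            ∎

toℕ-mod : ∀ m n → toℕ (n mod suc m) ≡ n % suc m
toℕ-mod m n = toℕ-fromℕ< _

mod-cong : ∀ a b → a % suc m ≡ b % suc m → a mod suc m ≡ b mod suc m
mod-cong {m} a b eq = toℕ-injective (trans (toℕ-mod m a) (trans eq (sym (toℕ-mod m b))))

mod-inverse : ∀ n {i : Fin (suc m)} → n % suc m ≡ toℕ i % suc m → n mod suc m ≡ i
mod-inverse {m} n {i} eq =
  toℕ-injective (trans (toℕ-mod m n) (trans eq (m<n⇒m%n≡m (toℕ<n i))))

next-prev : (i : Fin (suc m)) → next (prev i) ≡ i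
next-prev {m} i = mod-inverse (suc (toℕ (prev i))) (begin
  suc (toℕ (prev i)) % suc m   ≡⟨ cong (λ r → suc r % suc m) (toℕ-mod m (toℕ i + m)) ⟩
  suc ((toℕ i + m) % suc m) % suc m  ≡⟨ [o+m%n]%n≡[o+m]%n (toℕ i + m) 1 m ⟩
  suc (toℕ i + m) % suc m      ≡⟨ cong (_% suc m) (+-comm (suc (toℕ i)) m) ⟩
  (m + suc (toℕ i)) % suc m    ≡⟨ [m+1+k]%[1+m]≡k%[1+m] m (toℕ i) ⟩
  toℕ i % suc m                ∎)

prev-next : (i : Fin (suc m)) → prev (next i) ≡ i
prev-next {m} i = mod-inverse (toℕ (next i) + m) (begin
  (toℕ (next i) + m) % suc m        ≡⟨ cong (λ r → (r + m) % suc m) (toℕ-mod m (suc (toℕ i))) ⟩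
  (suc (toℕ i) % suc m + m) % suc m ≡⟨ [m%n+o]%n≡[m+o]%n (suc (toℕ i)) m m ⟩
  (suc (toℕ i) + m) % suc m         ≡⟨ cong (_% suc m) (+-comm (suc (toℕ i)) m) ⟩
  (m + suc (toℕ i)) % suc m         ≡⟨ [m+1+k]%[1+m]≡k%[1+m] m (toℕ i) ⟩
  toℕ i % suc m                     ∎)

shift-mod-injective : ∀ k (i j : Fin (suc m)) → (toℕ i + k) mod suc m ≡ (toℕ j + k) mod suc m → i ≡ j
shift-mod-injective {m} k i j eq = toℕ-injective (begin
  toℕ i          ≡⟨ sym (m<n⇒m%n≡m (toℕ<n i)) ⟩
  toℕ i % suc m  ≡⟨ %-cancelʳ-+ (toℕ i) (toℕ j) k m shifted ⟩
  toℕ j % suc m  ≡⟨ m<n⇒m%n≡m (toℕ<n j) ⟩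
  toℕ j          ∎)
  where
  shifted : (toℕ i + k) % suc m ≡ (toℕ j + k) % suc m
  shifted = trans (sym (toℕ-mod m (toℕ i + k))) (trans (cong toℕ eq) (toℕ-mod m (toℕ j + k)))

lookupᶜ : Word d m → ℕ → Fin (suc d)
lookupᶜ {m = m} w n = lookup w (n mod suc m)

lookupᶜ-cong : (w : Word d m) (a b : ℕ) → a % suc m ≡ b % suc m → lookupᶜ w a ≡ lookupᶜ w b
lookupᶜ-cong w a b eq = cong (lookup w) (mod-cong a b eq)

lookup-rotate : (w : Word d m) (k : ℕ) (i : Fin (suc m)) → lookup (rotate w k) i ≡ lookupᶜ w (toℕ i + k)
lookup-rotate {m = m} w k = lookup∘tabulate (λ i → lookupᶜ w (toℕ i + k))

lookupᶜ-rotate : (w : Word d m) (k n : ℕ) → lookupᶜ (rotate w k) n ≡ lookupᶜ w (n + k)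
lookupᶜ-rotate {m = m} w k n =
  trans (lookup-rotate w k (n mod suc m)) (lookupᶜ-cong w (toℕ (n mod suc m) + k) (n + k)
    (trans (cong (λ r → (r + k) % suc m) (toℕ-mod m n)) ([m%n+o]%n≡[m+o]%n n k m)))

isVertex⇒lookupᶜ-≢ : (w : Word d m) → IsVertex w → ∀ n → lookupᶜ w n ≢ lookupᶜ w (suc n)
isVertex⇒lookupᶜ-≢ {m = m} w h n eq =
  h (n mod suc m) (trans eq (lookupᶜ-cong w (suc n) (suc (toℕ (n mod suc m))) next-index))
  where
  next-index : suc n % suc m ≡ suc (toℕ (n mod suc m)) % suc m
  next-index = begin
    suc n % suc m                    ≡⟨ sym ([o+m%n]%n≡[o+m]%n n 1 m) ⟩
    suc (n % suc m) % suc m          ≡⟨ cong (λ r → suc r % suc m) (sym (toℕ-mod m n)) ⟩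
    suc (toℕ (n mod suc m)) % suc m  ∎

lookup-extensionality : {A : Set} {n : ℕ} {u v : Vec A n} → (∀ i → lookup u i ≡ lookup v i) → u ≡ v
lookup-extensionality {u = u} {v} eq =
  trans (sym (tabulate∘lookup u)) (trans (tabulate-cong eq) (tabulate∘lookup v))

lookup-∷ʳ-last : {A : Set} {n : ℕ} (xs : Vec A n) (x : A) → lookup (xs ∷ʳ x) (fromℕ n) ≡ x
lookup-∷ʳ-last []       x = refl
lookup-∷ʳ-last (y ∷ xs) x = lookup-∷ʳ-last xs x

lookup-∷ʳ-inject₁ : {A : Set} {n : ℕ} (xs : Vec A n) (x : A) (i : Fin n) →
                    lookup (xs ∷ʳ x) (inject₁ i) ≡ lookup xs i
lookup-∷ʳ-inject₁ (y ∷ xs) x Fin.zero    = refl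
lookup-∷ʳ-inject₁ (y ∷ xs) x (Fin.suc i) = lookup-∷ʳ-inject₁ xs x i

rotate-zero : (w : Word d m) → rotate w 0 ≡ w
rotate-zero {m = m} w = lookup-extensionality λ i → trans (lookup-rotate w 0 i)
  (cong (lookup w) (mod-inverse (toℕ i + 0) (cong (_% suc m) (+-identityʳ (toℕ i)))))

rotate-cong : (w : Word d m) (a b : ℕ) → a % suc m ≡ b % suc m → rotate w a ≡ rotate w b
rotate-cong {m = m} w a b eq = lookup-extensionality λ i → begin
  lookup (rotate w a) i  ≡⟨ lookup-rotate w a i ⟩
  lookupᶜ w (toℕ i + a)  ≡⟨ lookupᶜ-cong w (toℕ i + a) (toℕ i + b) (shift-cong (toℕ i)) ⟩
  lookupᶜ w (toℕ i + b)  ≡⟨ sym (lookup-rotate w b i) ⟩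
  lookup (rotate w b) i  ∎
  where
  shift-cong : ∀ n → (n + a) % suc m ≡ (n + b) % suc m
  shift-cong n = trans (sym ([o+m%n]%n≡[o+m]%n a n m))
    (trans (cong (λ r → (n + r) % suc m) eq) ([o+m%n]%n≡[o+m]%n b n m))

rotate-rotate : (w : Word d m) (a b : ℕ) → rotate (rotate w a) b ≡ rotate w (b + a)
rotate-rotate w a b = lookup-extensionality λ i → begin
  lookup (rotate (rotate w a) b) i  ≡⟨ lookup-rotate (rotate w a) b i ⟩
  lookupᶜ (rotate w a) (toℕ i + b)  ≡⟨ lookupᶜ-rotate w a (toℕ i + b) ⟩
  lookupᶜ w (toℕ i + b + a)         ≡⟨ cong (lookupᶜ w) (+-assoc (toℕ i) b a) ⟩
  lookupᶜ w (toℕ i + (b + a))       ≡⟨ sym (lookup-rotate w (b + a) i) ⟩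
  lookup (rotate w (b + a)) i       ∎

rotate-length : (w : Word d m) → rotate w (suc m) ≡ w
rotate-length {m = m} w = trans (rotate-cong w (suc m) 0 (n%n≡0 (suc m))) (rotate-zero w)

∷ʳ-tail≡rotate-update : (u : Word d m) (x : Fin (suc d)) → tail u ∷ʳ x ≡ rotate u 1 [ fromℕ m ]≔ x
∷ʳ-tail≡rotate-update {m = m} u@(_ ∷ us) x = lookup-extensionality λ j → pointwise j (view j)
  where
  pointwise : ∀ j → View j →
              lookup (us ∷ʳ x) j ≡ lookup (rotate u 1 [ fromℕ m ]≔ x) j
  pointwise _ ‵fromℕ = trans (lookup-∷ʳ-last us x) (sym (lookup∘update (fromℕ m) (rotate u 1) x))
  pointwise _ (‵inject₁ i) = begin
    lookup (us ∷ʳ x) (inject₁ i)                      ≡⟨ lookup-∷ʳ-inject₁ us x i ⟩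
    lookup u (Fin.suc i)                              ≡⟨ cong (lookup u) (sym next-index) ⟩
    lookupᶜ u (toℕ (inject₁ i) + 1)                   ≡⟨ sym (lookup-rotate u 1 (inject₁ i)) ⟩
    lookup (rotate u 1) (inject₁ i)                   ≡⟨ sym (lookup∘update′ (fromℕ≢inject₁ ∘ sym) (rotate u 1) x) ⟩
    lookup (rotate u 1 [ fromℕ m ]≔ x) (inject₁ i)    ∎
    where
    next-index : (toℕ (inject₁ i) + 1) mod suc m ≡ Fin.suc i
    next-index = mod-inverse (toℕ (inject₁ i) + 1)
      (cong (_% suc m) (trans (cong (_+ 1) (toℕ-inject₁ i)) (+-comm (toℕ i) 1)))

last+suc-%≡-% : ∀ m k → (toℕ (fromℕ m) + suc k) % suc m ≡ k % suc m
last+suc-%≡-% m k =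
  trans (cong (λ r → (r + suc k) % suc m) (toℕ-fromℕ m)) ([m+1+k]%[1+m]≡k%[1+m] m k)

rotate-suc : (w : Word d m) (k : ℕ) → rotate w (suc k) ≡ tail (rotate w k) ∷ʳ lookupᶜ w k
rotate-suc {m = m} w k = begin
  rotate w (suc k)
    ≡⟨ sym ([]≔-lookup _ (fromℕ m)) ⟩
  rotate w (suc k) [ fromℕ m ]≔ lookup (rotate w (suc k)) (fromℕ m)
    ≡⟨ cong (rotate w (suc k) [ fromℕ m ]≔_) last-symbol ⟩
  rotate w (suc k) [ fromℕ m ]≔ lookupᶜ w k
    ≡⟨ cong (_[ fromℕ m ]≔ lookupᶜ w k) (sym (rotate-rotate w k 1)) ⟩
  rotate (rotate w k) 1 [ fromℕ m ]≔ lookupᶜ w k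
    ≡⟨ sym (∷ʳ-tail≡rotate-update (rotate w k) (lookupᶜ w k)) ⟩
  tail (rotate w k) ∷ʳ lookupᶜ w k
    ∎
  where
  last-symbol : lookup (rotate w (suc k)) (fromℕ m) ≡ lookupᶜ w k
  last-symbol = trans (lookup-rotate w (suc k) (fromℕ m))
                      (lookupᶜ-cong w (toℕ (fromℕ m) + suc k) k (last+suc-%≡-% m k))

rotate-update : (w : Word d m) (i j : Fin (suc m)) (x : Fin (suc d)) (k : ℕ) →
                (toℕ j + k) mod suc m ≡ i → rotate (w [ i ]≔ x) k ≡ rotate w k [ j ]≔ x
rotate-update {m = m} w i j x k j+k≡i = lookup-extensionality pointwise
  where
  pointwise : ∀ p → lookup (rotate (w [ i ]≔ x) k) p ≡ lookup (rotate w k [ j ]≔ x) p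
  pointwise p with p ≟ j
  ... | yes refl = begin
    lookup (rotate (w [ i ]≔ x) k) p  ≡⟨ lookup-rotate (w [ i ]≔ x) k p ⟩
    lookupᶜ (w [ i ]≔ x) (toℕ p + k)  ≡⟨ cong (lookup (w [ i ]≔ x)) j+k≡i ⟩
    lookup (w [ i ]≔ x) i             ≡⟨ lookup∘update i w x ⟩
    x                                 ≡⟨ sym (lookup∘update p (rotate w k) x) ⟩
    lookup (rotate w k [ p ]≔ x) p    ∎
  ... | no p≢j = begin
    lookup (rotate (w [ i ]≔ x) k) p  ≡⟨ lookup-rotate (w [ i ]≔ x) k p ⟩
    lookupᶜ (w [ i ]≔ x) (toℕ p + k)  ≡⟨ lookup∘update′ p+k≢i w x ⟩
    lookupᶜ w (toℕ p + k)             ≡⟨ sym (lookup-rotate w k p) ⟩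
    lookup (rotate w k) p             ≡⟨ sym (lookup∘update′ p≢j (rotate w k) x) ⟩
    lookup (rotate w k [ j ]≔ x) p    ∎
    where
    p+k≢i : (toℕ p + k) mod suc m ≢ i
    p+k≢i eq = p≢j (shift-mod-injective k p j (trans eq (sym j+k≡i)))

rotate-isVertex : (w : Word d m) → IsVertex w → ∀ k → IsVertex (rotate w k)
rotate-isVertex {m = m} w h k i eq = isVertex⇒lookupᶜ-≢ w h (toℕ i + k) (begin
  lookupᶜ w (toℕ i + k)         ≡⟨ sym (lookup-rotate w k i) ⟩
  lookup (rotate w k) i         ≡⟨ eq ⟩
  lookup (rotate w k) (next i)  ≡⟨ lookup-rotate w k (next i) ⟩
  lookupᶜ w (toℕ (next i) + k)  ≡⟨ lookupᶜ-cong w (toℕ (next i) + k) (suc (toℕ i) + k) next-index ⟩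
  lookupᶜ w (suc (toℕ i) + k)   ∎)
  where
  next-index : (toℕ (next i) + k) % suc m ≡ (suc (toℕ i) + k) % suc m
  next-index = trans (cong (λ r → (r + k) % suc m) (toℕ-mod m (suc (toℕ i))))
                     ([m%n+o]%n≡[m+o]%n (suc (toℕ i)) k m)

update-isVertex : (w : Word d m) (i : Fin (suc m)) (x : Fin (suc d)) → IsVertex w →
                  x ≢ lookup w (prev i) → x ≢ lookup w (next i) → IsVertex (w [ i ]≔ x)
update-isVertex w i x h x≢prev x≢next j with j ≟ i | next j ≟ i
... | yes refl | yes next≡j = λ _ → h j (cong (lookup w) (sym next≡j))
... | yes refl | no next≢j  = λ eq →
  x≢next (trans (sym (lookup∘update j w x)) (trans eq (lookup∘update′ next≢j w x)))
... | no j≢i   | yes refl   = λ eq → x≢prev (begin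
  x                                  ≡⟨ sym (lookup∘update (next j) w x) ⟩
  lookup (w [ next j ]≔ x) (next j)  ≡⟨ sym eq ⟩
  lookup (w [ next j ]≔ x) j         ≡⟨ lookup∘update′ j≢i w x ⟩
  lookup w j                         ≡⟨ cong (lookup w) (sym (prev-next j)) ⟩
  lookup w (prev (next j))           ∎)
... | no j≢i   | no next≢i  = λ eq →
  h j (trans (sym (lookup∘update′ j≢i w x)) (trans eq (lookup∘update′ next≢i w x)))

update-≢ : (w : Word d m) (i j : Fin (suc m)) (x : Fin (suc d)) →
           lookup (w [ i ]≔ x) j ≢ x → lookup w j ≢ x
update-≢ w i j x t≢x with j ≟ i
... | yes refl = contradiction (lookup∘update i w x) t≢x
... | no j≢i   = subst (_≢ x) (lookup∘update′ j≢i w x) t≢x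

isVertex-update⇒valid : (w : Word d m) (i : Fin (suc m)) (x : Fin (suc d)) →
                        IsVertex (w [ i ]≔ x) → x ≢ lookup w (prev i) × x ≢ lookup w (next i)
isVertex-update⇒valid w i x h =
  ≢-sym (update-≢ w i (prev i) x (subst (lookup t (prev i) ≢_) t-at-next-prev (h (prev i)))) ,
  ≢-sym (update-≢ w i (next i) x (≢-sym (subst (_≢ lookup t (next i)) (lookup∘update i w x) (h i))))
  where
  t : Word _ _
  t = w [ i ]≔ x
  t-at-next-prev : lookup t (next (prev i)) ≡ x
  t-at-next-prev = trans (cong (lookup t) (next-prev i)) (lookup∘update i w x)

_++ᴾ_ : {u w v : Word d m} → Path u w → Path w v → Path u v
here      ++ᴾ q = q
there a p ++ᴾ q = there a (p ++ᴾ q)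

_++ᴼ_ : {u w v : Word d m} → Ops u w → Ops w v → Ops u v
done     ++ᴼ q = q
step o p ++ᴼ q = step o (p ++ᴼ q)

rotation-path : (w : Word d m) → IsVertex w → ∀ k → Path w (rotate w k)
rotation-path w h zero    = subst (Path w) (sym (rotate-zero w)) here
rotation-path w h (suc k) =
  rotation-path w h k ++ᴾ there arc here
  where
  arc : Arc (rotate w k) (rotate w (suc k))
  arc = rotate-isVertex w h k , rotate-isVertex w h (suc k) , lookupᶜ w k , rotate-suc w k

swap-path : (w : Word d m) (i : Fin (suc m)) (x : Fin (suc d)) → IsVertex w →
            x ≢ lookup w (prev i) → x ≢ lookup w (next i) → Path w (w [ i ]≔ x)
swap-path {m = m} w i x h x≢prev x≢next =
  rotation-path w h (toℕ i) ++ᴾ there append-x (subst (Path _) back (rotation-path _ ht′ (m ∸ toℕ i)))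
  where
  t : Word _ m
  t = w [ i ]≔ x
  ht : IsVertex t
  ht = update-isVertex w i x h x≢prev x≢next
  ht′ : IsVertex (rotate t (suc (toℕ i)))
  ht′ = rotate-isVertex t ht (suc (toℕ i))
  last-reads-i : (toℕ (fromℕ m) + suc (toℕ i)) mod suc m ≡ i
  last-reads-i = mod-inverse (toℕ (fromℕ m) + suc (toℕ i)) (last+suc-%≡-% m (toℕ i))
  append-x : Arc (rotate w (toℕ i)) (rotate t (suc (toℕ i)))
  append-x = rotate-isVertex w h (toℕ i) , ht′ , x , (begin
    rotate t (suc (toℕ i))
      ≡⟨ rotate-update w i (fromℕ m) x (suc (toℕ i)) last-reads-i ⟩
    rotate w (suc (toℕ i)) [ fromℕ m ]≔ x
      ≡⟨ cong (_[ fromℕ m ]≔ x) (sym (rotate-rotate w (toℕ i) 1)) ⟩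
    rotate (rotate w (toℕ i)) 1 [ fromℕ m ]≔ x
      ≡⟨ sym (∷ʳ-tail≡rotate-update (rotate w (toℕ i)) x) ⟩
    tail (rotate w (toℕ i)) ∷ʳ x
      ∎)
  back : rotate (rotate t (suc (toℕ i))) (m ∸ toℕ i) ≡ t
  back = begin
    rotate (rotate t (suc (toℕ i))) (m ∸ toℕ i)  ≡⟨ rotate-rotate t (suc (toℕ i)) (m ∸ toℕ i) ⟩
    rotate t (m ∸ toℕ i + suc (toℕ i))           ≡⟨ cong (rotate t) (+-suc (m ∸ toℕ i) (toℕ i)) ⟩
    rotate t (suc (m ∸ toℕ i + toℕ i))           ≡⟨ cong (rotate t ∘ suc) (m∸n+n≡m (toℕ≤pred[n] i)) ⟩
    rotate t (suc m)                             ≡⟨ rotate-length t ⟩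
    t                                            ∎

op-isVertex : {u v : Word d m} → IsVertex u → Op u v → IsVertex v
op-isVertex h (rot w k)                  = rotate-isVertex w h k
op-isVertex h (swap w i x x≢prev x≢next) = update-isVertex w i x h x≢prev x≢next

op-path : {u v : Word d m} → IsVertex u → Op u v → Path u v
op-path h (rot w k)                  = rotation-path w h k
op-path h (swap w i x x≢prev x≢next) = swap-path w i x h x≢prev x≢next

ops-path : {u v : Word d m} → IsVertex u → Ops u v → Path u v
ops-path h done        = here
ops-path h (step o os) = op-path h o ++ᴾ ops-path (op-isVertex h o) os

arc-ops : {u v : Word d m} → Arc u v → Ops u v
arc-ops {m = m} {u = u} (_ , hv , x , refl) =
  step (rot u 1) (subst (Ops (rotate u 1)) (sym shifted)
    (swap-last (isVertex-update⇒valid (rotate u 1) (fromℕ m) x (subst IsVertex shifted hv))))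
  where
  shifted : tail u ∷ʳ x ≡ rotate u 1 [ fromℕ m ]≔ x
  shifted = ∷ʳ-tail≡rotate-update u x
  swap-last : x ≢ lookup (rotate u 1) (prev (fromℕ m)) × x ≢ lookup (rotate u 1) (next (fromℕ m)) →
              Ops (rotate u 1) (rotate u 1 [ fromℕ m ]≔ x)
  swap-last (x≢prev , x≢next) = step (swap (rotate u 1) (fromℕ m) x x≢prev x≢next) done

path-ops : {u v : Word d m} → Path u v → Ops u v
path-ops here        = done
path-ops (there a p) = arc-ops a ++ᴼ path-ops p

lemma5 : (d m : ℕ) → 1 ≤ d → 2 ≤ suc m →
    (u v : Word d m) → IsVertex u → IsVertex v →
    (Path u v → Ops u v) × (Ops u v → Path u v)
lemma5 d m _ _ u v hu _ = path-ops , ops-path hu
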